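{- Let $\mathcal{M}=(V,\mathcal{I})$ be a matroid, let $\rho^*=\max_{U\subseteq V}\rho_{\mathcal{M}}(U)$, assume $\rho^*<+\infty$, and let $B\subseteq V$ satisfy $\rho_{\mathcal{M}}(B)=\rho^*$. Then for every $A\subsetneq B$, $\rho_{\mathcal{M}/A}(B\setminus A)\ge\rho^*$.
   Context: For a matroid $\mathcal{N}$ and a subset $U$ of its ground set, $\rho_{\mathcal{N}}(U)=|U|/\mathrm{rank}_{\mathcal{N}}(U)$, with $\rho_{\mathcal{N}}(\emptyset)=0$ and $\rho_{\mathcal{N}}(U)=+\infty$ if $U\ne\emptyset$ has rank $0$. $\mathcal{M}/A$ is the contraction of $\mathcal{M}$ by $A$: ground set $V\setminus A$, independent sets $\{S\subseteq V\setminus A: S\cup B_A\in\mathcal{I}\}$ for a maximal independent $B_A\subseteq A$. -}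

module Defs where

open import Level using (0ℓ)
open import Data.Nat using (ℕ; zero; suc; _⊔_; _<_)
open import Data.Integer using (+_)
open import Data.Rational using (ℚ; _/_) renaming (_≤_ to _≤ℚ_)
open import Data.Rational using (0ℚ)
open import Data.Bool using (true; false)
open import Data.Vec using ([]; _∷_)
open import Data.List using (List; []; _∷_; _++_; map; filter; foldr)
open import Data.Fin using (Fin)
open import Data.Fin.Subset using (Subset; _⊆_; _∪_; _∩_; ∁; ∣_∣; ⁅_⁆; _∈_; _∉_; ⊥; inside; outside)
open import Data.Fin.Subset.Properties using (_⊆?_)
open import Data.Product using (Σ; _×_; _,_)
open import Relation.Nullary using (Dec; ¬_)
open import Relation.Nullary.Decidable using (_×-dec_)
open import Relation.Binary.PropositionalEquality using (_≡_)

record IndepSystem (n : ℕ) : Set₁ where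
  field
    Ind  : Subset n → Set
    Ind? : (S : Subset n) → Dec (Ind S)
open IndepSystem public

record Matroid (n : ℕ) : Set₁ where
  field
    system   : IndepSystem n
  field
    ind-empty : Ind system ⊥
    ind-down  : ∀ {I J} → J ⊆ I → Ind system I → Ind system J
    ind-exch  : ∀ {I J} → Ind system I → Ind system J → ∣ I ∣ < ∣ J ∣ →
                Σ (Fin n) λ x → x ∈ J × x ∉ I × Ind system (I ∪ ⁅ x ⁆)
open Matroid public

allSubsets : ∀ n → List (Subset n)
allSubsets zero = [] ∷ []
allSubsets (suc n) = map (outside ∷_) (allSubsets n) ++ map (inside ∷_) (allSubsets n)

maxList : List ℕ → ℕ
maxList = foldr _⊔_ 0

rank : ∀ {n} → IndepSystem n → Subset n → ℕ
rank {n} S U =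
  maxList (map ∣_∣ (filter (λ I → (I ⊆? U) ×-dec Ind? S I) (allSubsets n)))

data ℚ∞ : Set where
  fin : ℚ → ℚ∞
  ∞   : ℚ∞

data _≤∞_ : ℚ∞ → ℚ∞ → Set where
  fin≤fin : ∀ {p q} → p ≤ℚ q → fin p ≤∞ fin q
  _≤∞∞    : ∀ x → x ≤∞ ∞

-- |U| / r with ρ = 0 for |U| = 0 and ρ = +∞ for |U| > 0, r = 0.
ratio : ℕ → ℕ → ℚ∞
ratio zero    _       = fin 0ℚ
ratio (suc a) zero    = ∞
ratio (suc a) (suc r) = fin ((+ suc a) / suc r)

ρ : ∀ {n} → IndepSystem n → Subset n → ℚ∞
ρ S U = ratio ∣ U ∣ (rank S U)

MaxIndepIn : ∀ {n} → Matroid n → Subset n → Subset n → Set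
MaxIndepIn M A BA =
  BA ⊆ A × Ind (system M) BA ×
  (∀ J → BA ⊆ J → J ⊆ A → Ind (system M) J → J ≡ BA)

-- Contraction M/A, with respect to a maximal independent B_A ⊆ A.
-- Its ground set is V \ A; we represent its subsets as subsets of Fin n
-- contained in ∁ A (independent sets are required to lie in V \ A).
contract : ∀ {n} → Matroid n → (A BA : Subset n) → IndepSystem n
contract M A BA = record
  { Ind  = λ S → S ⊆ ∁ A × Ind (system M) (S ∪ BA)
  ; Ind? = λ S → (S ⊆? ∁ A) ×-dec Ind? (system M) (S ∪ BA)
  }

_⊊_ : ∀ {n} → Subset n → Subset n → Set
A ⊊ B = A ⊆ B × ¬ (A ≡ B)

-- Write a = |A|, c = |B \ A|, R = rank B and r' = rank_{M/A}(B \ A). By the exchange axiom a maximal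
-- independent B_A ⊆ A is a basis of A, so rank A ≤ |B_A|; and B_A together with an independent set of
-- M/A inside B \ A is a disjoint independent subset of B, so rank A + r' ≤ R. Now ρ(A) ≤ ρ(B) reads
-- a / rank A ≤ (a + c) / R, and a mediant argument turns this into (a + c) / R ≤ c / r'.
module Submission where

open import Defs
open import Data.Nat using (zero; suc; _+_; _*_; _≤_; _<_; _∸_; z≤n; s≤s)
open import Data.Nat.Properties
open import Data.Integer using (+_; +≤+)
open import Data.Integer.Properties using (drop‿+≤+)
open import Data.Rational using (_/_) renaming (_≤_ to _≤ℚ_)
open import Data.Rational.Properties using (toℚᵘ-mono-≤; toℚᵘ-cancel-≤; toℚᵘ-fromℚᵘ)
open import Data.Rational.Unnormalised using (mkℚᵘ; *≤*)
open import Data.Rational.Unnormalised.Properties using (≤-respˡ-≃; ≤-respʳ-≃; ≃-sym)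
open import Data.Vec using ([]; _∷_; here; there)
open import Data.List using ([]; _∷_; map; filter)
open import Data.List.Relation.Unary.Any using (here; there)
open import Data.List.Membership.Propositional using () renaming (_∈_ to _∈ˡ_)
open import Data.List.Membership.Propositional.Properties
  using (∈-filter⁺; ∈-filter⁻; ∈-++⁺ˡ; ∈-++⁺ʳ; ∈-map⁺; ∈-map⁻)
open import Data.Fin.Subset using (Subset; _⊆_; _∪_; _∩_; ∁; ∣_∣; ⁅_⁆; _∈_; _∉_; inside; outside)
open import Data.Fin.Subset.Properties
  using (_⊆?_; drop-∷-⊆; p∩q⊆p; x∈p∪q⁺; x∈p∪q⁻; x∈⁅x⁆; x∈⁅y⁆⇒x≡y; x∈∁p⇒x∉p)
open import Data.Product using (_×_; _,_; ∃-syntax)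
open import Data.Sum using (inj₁; inj₂)
open import Relation.Nullary using (¬_; contradiction)
open import Relation.Nullary.Decidable using (_×-dec_)
open import Relation.Binary.PropositionalEquality using (_≡_; refl; sym; trans; cong; subst)

/-≤⇒*-≤ : ∀ a b c d → (+ suc a) / suc b ≤ℚ (+ suc c) / suc d → suc a * suc d ≤ suc c * suc b
/-≤⇒*-≤ a b c d p with
  ≤-respʳ-≃ (toℚᵘ-fromℚᵘ (mkℚᵘ (+ suc c) d))
    (≤-respˡ-≃ (toℚᵘ-fromℚᵘ (mkℚᵘ (+ suc a) b)) (toℚᵘ-mono-≤ p))
... | *≤* ad≤cb = drop‿+≤+ ad≤cb

*-≤⇒/-≤ : ∀ a b c d → suc a * suc d ≤ suc c * suc b → (+ suc a) / suc b ≤ℚ (+ suc c) / suc d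
*-≤⇒/-≤ a b c d ad≤cb = toℚᵘ-cancel-≤
  (≤-respʳ-≃ (≃-sym (toℚᵘ-fromℚᵘ (mkℚᵘ (+ suc c) d)))
    (≤-respˡ-≃ (≃-sym (toℚᵘ-fromℚᵘ (mkℚᵘ (+ suc a) b))) (*≤* (+≤+ ad≤cb))))

ratio-≤⇒*-≤ : ∀ a r b s → ¬ ratio a r ≡ ∞ →
              ratio a r ≤∞ ratio (suc b) (suc s) → a * suc s ≤ suc b * r
ratio-≤⇒*-≤ zero    r       b s _      _               = z≤n
ratio-≤⇒*-≤ (suc a) zero    b s finite _               = contradiction refl finite
ratio-≤⇒*-≤ (suc a) (suc r) b s _      (fin≤fin as≤br) = /-≤⇒*-≤ a r b s as≤br

*-≤⇒ratio-≤ : ∀ b s c r → suc b * r ≤ suc c * s → ratio (suc b) s ≤∞ ratio (suc c) r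
*-≤⇒ratio-≤ b s       c zero    _     = _ ≤∞∞
*-≤⇒ratio-≤ b zero    c (suc r) br≤cs with () ← subst (suc b * suc r ≤_) (*-zeroʳ (suc c)) br≤cs
*-≤⇒ratio-≤ b (suc s) c (suc r) br≤cs = fin≤fin (*-≤⇒/-≤ b s c r br≤cs)

mediant-*-≤ : ∀ {a c b rA r R} → b ≡ a + c → r + rA ≤ R → a * R ≤ b * rA → b * r ≤ c * R
mediant-*-≤ {a} {c} {b} {rA} {r} {R} b≡a+c r+rA≤R aR≤brA = +-cancelʳ-≤ (b * rA) (b * r) (c * R) (begin
  b * r + b * rA  ≡⟨ *-distribˡ-+ b r rA ⟨
  b * (r + rA)    ≤⟨ *-monoʳ-≤ b r+rA≤R ⟩
  b * R           ≡⟨ cong (_* R) b≡a+c ⟩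
  (a + c) * R     ≡⟨ *-distribʳ-+ R a c ⟩
  a * R + c * R   ≤⟨ +-monoˡ-≤ (c * R) aR≤brA ⟩
  b * rA + c * R  ≡⟨ +-comm (b * rA) (c * R) ⟩
  c * R + b * rA  ∎)
  where open ≤-Reasoning

ratio-mediant-≤ : ∀ a c b rA r R → b ≡ a + c → 0 < c → r + rA ≤ R →
                  ¬ ratio a rA ≡ ∞ → ¬ ratio b R ≡ ∞ →
                  ratio a rA ≤∞ ratio b R → ratio b R ≤∞ ratio c r
ratio-mediant-≤ a (suc c) zero    rA r R       b≡a+c _ _ _ _ _
  with () ← trans b≡a+c (+-suc a c)
ratio-mediant-≤ a (suc c) (suc b) rA r zero    _ _ _ _ finiteB _ = contradiction refl finiteB
ratio-mediant-≤ a (suc c) (suc b) rA r (suc R) b≡a+c _ r+rA≤R finiteA _ ρA≤ρB =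
  *-≤⇒ratio-≤ b (suc R) c r (mediant-*-≤ b≡a+c r+rA≤R (ratio-≤⇒*-≤ a rA b R finiteA ρA≤ρB))

∣q∣≡∣p∣+∣q∩∁p∣ : ∀ {n} (p q : Subset n) → p ⊆ q → ∣ q ∣ ≡ ∣ p ∣ + ∣ q ∩ ∁ p ∣
∣q∣≡∣p∣+∣q∩∁p∣ []            []            _   = refl
∣q∣≡∣p∣+∣q∩∁p∣ (inside  ∷ p) (inside  ∷ q) p⊆q = cong suc (∣q∣≡∣p∣+∣q∩∁p∣ p q (drop-∷-⊆ p⊆q))
∣q∣≡∣p∣+∣q∩∁p∣ (inside  ∷ p) (outside ∷ q) p⊆q with () ← p⊆q here
∣q∣≡∣p∣+∣q∩∁p∣ (outside ∷ p) (inside  ∷ q) p⊆q =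
  trans (cong suc (∣q∣≡∣p∣+∣q∩∁p∣ p q (drop-∷-⊆ p⊆q))) (sym (+-suc ∣ p ∣ _))
∣q∣≡∣p∣+∣q∩∁p∣ (outside ∷ p) (outside ∷ q) p⊆q = ∣q∣≡∣p∣+∣q∩∁p∣ p q (drop-∷-⊆ p⊆q)

p⊊q⇒0<∣q∩∁p∣ : ∀ {n} (p q : Subset n) → p ⊊ q → 0 < ∣ q ∩ ∁ p ∣
p⊊q⇒0<∣q∩∁p∣ []            []            (_   , p≢q) = contradiction refl p≢q
p⊊q⇒0<∣q∩∁p∣ (inside  ∷ p) (inside  ∷ q) (p⊆q , p≢q) =
  p⊊q⇒0<∣q∩∁p∣ p q (drop-∷-⊆ p⊆q , λ p≡q → p≢q (cong (inside ∷_) p≡q))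
p⊊q⇒0<∣q∩∁p∣ (inside  ∷ p) (outside ∷ q) (p⊆q , _) with () ← p⊆q here
p⊊q⇒0<∣q∩∁p∣ (outside ∷ p) (inside  ∷ q) _           = s≤s z≤n
p⊊q⇒0<∣q∩∁p∣ (outside ∷ p) (outside ∷ q) (p⊆q , p≢q) =
  p⊊q⇒0<∣q∩∁p∣ p q (drop-∷-⊆ p⊆q , λ p≡q → p≢q (cong (outside ∷_) p≡q))

∣p∪q∣≡∣p∣+∣q∣ : ∀ {n} (p q : Subset n) → (∀ {x} → x ∈ p → x ∉ q) → ∣ p ∪ q ∣ ≡ ∣ p ∣ + ∣ q ∣
∣p∪q∣≡∣p∣+∣q∣ []            []            _        = refl
∣p∪q∣≡∣p∣+∣q∣ (inside  ∷ p) (inside  ∷ q) disjoint with () ← disjoint here here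
∣p∪q∣≡∣p∣+∣q∣ (inside  ∷ p) (outside ∷ q) disjoint =
  cong suc (∣p∪q∣≡∣p∣+∣q∣ p q λ x∈p x∈q → disjoint (there x∈p) (there x∈q))
∣p∪q∣≡∣p∣+∣q∣ (outside ∷ p) (inside  ∷ q) disjoint =
  trans (cong suc (∣p∪q∣≡∣p∣+∣q∣ p q λ x∈p x∈q → disjoint (there x∈p) (there x∈q)))
        (sym (+-suc ∣ p ∣ _))
∣p∪q∣≡∣p∣+∣q∣ (outside ∷ p) (outside ∷ q) disjoint =
  ∣p∪q∣≡∣p∣+∣q∣ p q λ x∈p x∈q → disjoint (there x∈p) (there x∈q)

∈-allSubsets : ∀ {n} (p : Subset n) → p ∈ˡ allSubsets n
∈-allSubsets []            = here refl
∈-allSubsets (outside ∷ p) = ∈-++⁺ˡ (∈-map⁺ (outside ∷_) (∈-allSubsets p))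
∈-allSubsets {suc n} (inside ∷ p) =
  ∈-++⁺ʳ (map (outside ∷_) (allSubsets n)) (∈-map⁺ (inside ∷_) (∈-allSubsets p))

∈⇒≤maxList : ∀ {x} xs → x ∈ˡ xs → x ≤ maxList xs
∈⇒≤maxList (y ∷ ys) (here refl) = m≤m⊔n y (maxList ys)
∈⇒≤maxList (y ∷ ys) (there x∈ys) = ≤-trans (∈⇒≤maxList ys x∈ys) (m≤n⊔m y (maxList ys))

maxList≤ : ∀ {k} xs → (∀ {x} → x ∈ˡ xs → x ≤ k) → maxList xs ≤ k
maxList≤ []       _     = z≤n
maxList≤ (y ∷ ys) bound = ⊔-lub (bound (here refl)) (maxList≤ ys λ x∈ys → bound (there x∈ys))

∣indep∣≤rank : ∀ {n} (S : IndepSystem n) {U I : Subset n} → I ⊆ U → Ind S I → ∣ I ∣ ≤ rank S U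
∣indep∣≤rank {n} S {U} {I} I⊆U indI = ∈⇒≤maxList _
  (∈-map⁺ ∣_∣ (∈-filter⁺ (λ J → (J ⊆? U) ×-dec Ind? S J) (∈-allSubsets I) (I⊆U , indI)))

rank≤ : ∀ {n} (S : IndepSystem n) {U : Subset n} {k} →
        (∀ I → I ⊆ U → Ind S I → ∣ I ∣ ≤ k) → rank S U ≤ k
rank≤ {n} S {U} {k} bound = maxList≤ _ λ x∈sizes → size≤k (∈-map⁻ ∣_∣ x∈sizes)
  where
  size≤k : ∀ {x} → ∃[ I ] I ∈ˡ filter (λ J → (J ⊆? U) ×-dec Ind? S J) (allSubsets n) × x ≡ ∣ I ∣ → x ≤ k
  size≤k (I , I∈indeps , refl) with ∈-filter⁻ (λ J → (J ⊆? U) ×-dec Ind? S J) {xs = allSubsets n} I∈indeps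
  ... | _ , I⊆U , indI = bound I I⊆U indI

maxIndep-closed : ∀ {n} (M : Matroid n) {A BA : Subset n} {x} → MaxIndepIn M A BA →
                  x ∈ A → Ind (system M) (BA ∪ ⁅ x ⁆) → x ∈ BA
maxIndep-closed M {A} {BA} {x} (BA⊆A , _ , maximal) x∈A indBA+x =
  subst (x ∈_) BA+x≡BA (x∈p∪q⁺ (inj₂ (x∈⁅x⁆ x)))
  where
  BA+x⊆A : BA ∪ ⁅ x ⁆ ⊆ A
  BA+x⊆A y∈BA+x with x∈p∪q⁻ BA ⁅ x ⁆ y∈BA+x
  ... | inj₁ y∈BA  = BA⊆A y∈BA
  ... | inj₂ y∈⁅x⁆ = subst (_∈ A) (sym (x∈⁅y⁆⇒x≡y _ y∈⁅x⁆)) x∈A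
  BA+x≡BA : BA ∪ ⁅ x ⁆ ≡ BA
  BA+x≡BA = maximal (BA ∪ ⁅ x ⁆) (λ y∈BA → x∈p∪q⁺ (inj₁ y∈BA)) BA+x⊆A indBA+x

∣indep∣≤∣maxIndep∣ : ∀ {n} (M : Matroid n) {A BA J : Subset n} → MaxIndepIn M A BA →
                     J ⊆ A → Ind (system M) J → ∣ J ∣ ≤ ∣ BA ∣
∣indep∣≤∣maxIndep∣ M maxBA@(_ , indBA , _) J⊆A indJ = ≮⇒≥ λ ∣BA∣<∣J∣ →
  let (x , x∈J , x∉BA , indBA+x) = ind-exch M indBA indJ ∣BA∣<∣J∣
  in x∉BA (maxIndep-closed M maxBA (J⊆A x∈J) indBA+x)

rank≤∣maxIndep∣ : ∀ {n} (M : Matroid n) {A BA : Subset n} → MaxIndepIn M A BA →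
                  rank (system M) A ≤ ∣ BA ∣
rank≤∣maxIndep∣ M maxBA = rank≤ (system M) λ J J⊆A indJ → ∣indep∣≤∣maxIndep∣ M maxBA J⊆A indJ

rank-contract+∣B∣≤rank : ∀ {n} (M : Matroid n) {A BA X U : Subset n} →
                         BA ⊆ A → BA ⊆ U → Ind (system M) BA → X ⊆ U →
                         rank (contract M A BA) X + ∣ BA ∣ ≤ rank (system M) U
rank-contract+∣B∣≤rank M {A} {BA} {X} {U} BA⊆A BA⊆U indBA X⊆U =
  m≤o∸n⇒m+n≤o _ (∣indep∣≤rank S BA⊆U indBA) (rank≤ (contract M A BA) ∣I∣≤R∸∣BA∣)
  where
  S = system M
  ∣I∣≤R∸∣BA∣ : ∀ I → I ⊆ X → Ind (contract M A BA) I → ∣ I ∣ ≤ rank S U ∸ ∣ BA ∣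
  ∣I∣≤R∸∣BA∣ I I⊆X (I⊆∁A , indI∪BA) = m+n≤o⇒m≤o∸n ∣ I ∣
    (subst (_≤ rank S U) (∣p∪q∣≡∣p∣+∣q∣ I BA λ x∈I x∈BA → x∈∁p⇒x∉p (I⊆∁A x∈I) (BA⊆A x∈BA))
      (∣indep∣≤rank S I∪BA⊆U indI∪BA))
    where
    I∪BA⊆U : I ∪ BA ⊆ U
    I∪BA⊆U y∈I∪BA with x∈p∪q⁻ I BA y∈I∪BA
    ... | inj₁ y∈I  = X⊆U (I⊆X y∈I)
    ... | inj₂ y∈BA = BA⊆U y∈BA

proposition15 : ∀ {n} (M : Matroid n) →
    (∀ (U : Subset n) → ¬ (ρ (system M) U ≡ ∞)) →
    ∀ (B : Subset n) →
    (∀ (U : Subset n) → ρ (system M) U ≤∞ ρ (system M) B) →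
    ∀ (A : Subset n) → A ⊊ B →
    ∀ (BA : Subset n) → MaxIndepIn M A BA →
    ρ (system M) B ≤∞ ρ (contract M A BA) (B ∩ ∁ A)
proposition15 M finite B maxB A A⊊B@(A⊆B , _) BA maxBA@(BA⊆A , indBA , _) =
  ratio-mediant-≤ (∣ A ∣) (∣ B ∩ ∁ A ∣) (∣ B ∣) (rank S A) r' (rank S B)
    (∣q∣≡∣p∣+∣q∩∁p∣ A B A⊆B) (p⊊q⇒0<∣q∩∁p∣ A B A⊊B) r'+rankA≤rankB
    (finite A) (finite B) (maxB A)
  where
  S = system M
  r' = rank (contract M A BA) (B ∩ ∁ A)
  r'+rankA≤rankB : r' + rank S A ≤ rank S B
  r'+rankA≤rankB = ≤-trans (+-monoʳ-≤ r' (rank≤∣maxIndep∣ M maxBA))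
    (rank-contract+∣B∣≤rank M BA⊆A (λ y∈BA → A⊆B (BA⊆A y∈BA)) indBA (p∩q⊆p B (∁ A)))
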